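{- Let $G=(V,E)$ be a finite undirected graph with $n=|V|$ vertices. For any Customizable Hub Labeling $L$ of $G$ and any $\alpha\ge\frac12$, there are at least $\frac{2\alpha-1}{2\alpha}\cdot n$ vertices $v$ such that $|L(v)|\ge b_\alpha$.
   Context: A labeling is a function $L\colon V\to 2^V$. A Customizable Hub Labeling (CuHL) satisfies the customizable cover property: for any $s,t\in V$ and any $s$-$t$-path $P$ in $G$, $L(s)\cap L(t)$ contains a vertex of $P$. For $\alpha\in[0,1]$, an $\alpha$-balanced separator is a set $S\subseteq V$ such that every connected component of $G[V\setminus S]$ has at most $\alpha n$ vertices; $b_\alpha$ is the minimum size of an $\alpha$-balanced separator of $G$.
   Formalization: The parameter α ranges over the rationals in [1/2, 1]. -}

module Defs where

open import Data.Nat using (ℕ; _≤_)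
open import Data.Fin using (Fin)
open import Data.Fin.Subset using (Subset; ∣_∣; _∉_) renaming (_∈_ to _∈ₛ_)
open import Data.Fin.Subset.Properties using (_∈?_)
open import Data.List using (List; []; _∷_)
open import Data.List.Membership.Propositional using () renaming (_∈_ to _∈ₗ_)
open import Data.List.Relation.Unary.All using (All)
open import Data.List.Relation.Unary.Unique.Propositional using (Unique)
open import Data.Product using (Σ; ∃; _×_)
open import Data.Integer using (+_)
open import Data.Rational using (ℚ; _/_) renaming (_≤_ to _≤ℚ_; _*_ to _*ℚ_)
open import Data.Vec using (tabulate)
open import Data.Bool using (Bool)
open import Relation.Nullary.Decidable using (⌊_⌋)
open import Data.Nat using (_≤?_)
open import Level using (Level; suc; _⊔_) renaming (zero to lzero)
open import Relation.Binary.PropositionalEquality using (_≡_)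

record Graph (n : ℕ) : Set₁ where
  field
    Adj : Fin n → Fin n → Set
    sym : ∀ {u v} → Adj u v → Adj v u
open Graph public

Labeling : ℕ → Set
Labeling n = Fin n → Subset n

data IsWalk {n : ℕ} (G : Graph n) : Fin n → Fin n → List (Fin n) → Set where
  single : ∀ v → IsWalk G v v (v ∷ [])
  step   : ∀ {u v t vs} → Adj G u v → IsWalk G v t (v ∷ vs) → IsWalk G u t (u ∷ v ∷ vs)

IsPath : ∀ {n} → Graph n → Fin n → Fin n → List (Fin n) → Set
IsPath G s t vs = IsWalk G s t vs × Unique vs

IsCuHL : ∀ {n} → Graph n → Labeling n → Set
IsCuHL {n} G L =
  ∀ (s t : Fin n) (P : List (Fin n)) → IsPath G s t P →
    ∃ λ x → x ∈ₗ P × x ∈ₛ L s × x ∈ₛ L t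

ℕtoℚ : ℕ → ℚ
ℕtoℚ k = + k / 1

ConnectedAvoiding : ∀ {n} → Graph n → Subset n → Fin n → Fin n → Set
ConnectedAvoiding G S u v = ∃ λ P → IsPath G u v P × All (_∉ S) P

-- S is an α-balanced separator: every connected component of G[V \ S]
-- has at most α·n vertices.  The component of u ∉ S is the set of vertices
-- connected to u in G[V \ S]; "it has at most α n vertices" is expressed as:
-- every finite set C of vertices in that component has |C| ≤ α n.
IsBalancedSeparator : ∀ {n} → Graph n → ℚ → Subset n → Set
IsBalancedSeparator {n} G α S =
  ∀ (u : Fin n) → u ∉ S → ∀ (C : Subset n) →
    (∀ v → v ∈ₛ C → ConnectedAvoiding G S u v) →
    ℕtoℚ ∣ C ∣ ≤ℚ α *ℚ ℕtoℚ n

IsMinBalancedSeparatorSize : ∀ {n} → Graph n → ℚ → ℕ → Set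
IsMinBalancedSeparatorSize G α b =
  (∃ λ S → IsBalancedSeparator G α S × ∣ S ∣ ≡ b) ×
  (∀ S → IsBalancedSeparator G α S → b ≤ ∣ S ∣)

LargeLabels : ∀ {n} → Labeling n → ℕ → Subset n
LargeLabels L b = tabulate (λ v → ⌊ b ≤? ∣ L v ∣ ⌋)

-- Call v unbalanced if L(v) is not an α-balanced separator.  Every v with
-- |L(v)| < b_α is unbalanced, and an unbalanced v has a component C_v of
-- G − L(v) with more than αn ≥ n/2 vertices.  For unbalanced v and w, the
-- memberships w ∈ C_v and v ∈ C_w exclude each other: C_v and C_w share some x,
-- and the walks from w to x avoiding L(v) and from v to x avoiding L(w) join
-- into a v–w path missing L(v) ∩ L(w), against the cover property.  So
-- "w ∈ C_v" orients the set U of unbalanced vertices, and double counting gives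
-- some v ∈ U with |U ∩ C_v| ≤ |U|/2.  Hence αn < |C_v| ≤ |U|/2 + (n − |U|),
-- and as every vertex outside U has a large label, (2α − 1)n < ℓ for the number
-- ℓ of large labels; this is slightly stronger than (2α − 1)n ≤ 2αℓ.

module Submission where

open import Data.Nat as ℕ using (ℕ; z≤n)
import Data.Nat.Properties as ℕ
open import Data.Fin as Fin using (Fin)
open import Data.Fin.Properties using (any?)
open import Data.Fin.Subset using (Subset; ∣_∣; _∉_; _∩_; ∁; ⊤; Nonempty)
  renaming (_∈_ to _∈ₛ_; ⊥ to ∅)
open import Data.Fin.Subset.Properties using (_∈?_; p⊆q⇒∣p∣≤∣q∣; nonempty?; x∈∁p⇒x∉p; x∈p∩q⁻; ∣⊤∣≡n)
open import Data.Vec using (tabulate)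
import Data.List.Relation.Unary.All as All
open import Data.Product using (∃; _×_; _,_; proj₁; proj₂)
open import Data.Empty using (⊥; ⊥-elim)
open import Function using (_∘_)
open import Relation.Binary.PropositionalEquality using (_≡_; refl; sym; cong; subst; subst₂)
open import Relation.Nullary using (¬_; Dec; yes; no; ¬?)
open import Relation.Nullary.Decidable using (⌊_⌋; _×-dec_; decidable-stable; ¬¬-excluded-middle)
open import Relation.Nullary.Negation using (¬¬-map)
open import Defs hiding (sym)

module SubsetCardinality where

  open import Data.Nat
  open import Data.Nat.Properties
  open import Data.Unit using (tt)
  open import Data.Bool using (T)
  open import Data.Fin.Subset using (inside; outside)
  open import Data.Fin.Subset.Properties using (∣∁p∣≡n∸∣p∣; ∣p∣≤n; Empty-unique; ∣⊥∣≡0)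
  open import Data.Vec using ([]; _∷_)
  open import Data.Vec.Properties using ([]=⇒lookup; lookup⇒[]=; lookup∘tabulate)
  open import Relation.Binary.PropositionalEquality using (trans)
  open import Relation.Nullary.Decidable using (toWitness; dec-true; isYes≗does)
  open import Relation.Unary using (Decidable)

  ∈-tabulate⁻ : ∀ {n} {P : Fin n → Set} (P? : Decidable P) {x} → x ∈ₛ tabulate (λ y → ⌊ P? y ⌋) → P x
  ∈-tabulate⁻ P? {x} x∈ = toWitness (subst T (trans (sym ([]=⇒lookup x∈)) (lookup∘tabulate _ x)) tt)

  ∈-tabulate⁺ : ∀ {n} {P : Fin n → Set} (P? : Decidable P) {x} → P x → x ∈ₛ tabulate (λ y → ⌊ P? y ⌋)
  ∈-tabulate⁺ P? {x} px =
    lookup⇒[]= x _ (trans (lookup∘tabulate _ x) (trans (isYes≗does (P? x)) (dec-true (P? x) px)))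

  ∣p∣+∣∁p∣≡n : ∀ {n} (p : Subset n) → ∣ p ∣ + ∣ ∁ p ∣ ≡ n
  ∣p∣+∣∁p∣≡n p = trans (cong (∣ p ∣ +_) (∣∁p∣≡n∸∣p∣ p)) (m+[n∸m]≡n (∣p∣≤n p))

  ∣q∣≤∣p∩q∣+∣∁p∣ : ∀ {n} (p q : Subset n) → ∣ q ∣ ≤ ∣ p ∩ q ∣ + ∣ ∁ p ∣
  ∣q∣≤∣p∩q∣+∣∁p∣ []            []            = z≤n
  ∣q∣≤∣p∩q∣+∣∁p∣ (inside  ∷ p) (inside  ∷ q) = s≤s (∣q∣≤∣p∩q∣+∣∁p∣ p q)
  ∣q∣≤∣p∩q∣+∣∁p∣ (inside  ∷ p) (outside ∷ q) = ∣q∣≤∣p∩q∣+∣∁p∣ p q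
  ∣q∣≤∣p∩q∣+∣∁p∣ (outside ∷ p) (inside  ∷ q) =
    subst (suc ∣ q ∣ ≤_) (sym (+-suc _ _)) (s≤s (∣q∣≤∣p∩q∣+∣∁p∣ p q))
  ∣q∣≤∣p∩q∣+∣∁p∣ (outside ∷ p) (outside ∷ q) =
    ≤-trans (∣q∣≤∣p∩q∣+∣∁p∣ p q) (+-monoʳ-≤ ∣ p ∩ q ∣ (n≤1+n _))

  ∣p∣+∣q∣≤n+∣p∩q∣ : ∀ {n} (p q : Subset n) → ∣ p ∣ + ∣ q ∣ ≤ n + ∣ p ∩ q ∣
  ∣p∣+∣q∣≤n+∣p∩q∣ []            []            = z≤n
  ∣p∣+∣q∣≤n+∣p∩q∣ (inside  ∷ p) (inside  ∷ q) =
    s≤s (subst₂ _≤_ (sym (+-suc _ _)) (sym (+-suc _ _)) (s≤s (∣p∣+∣q∣≤n+∣p∩q∣ p q)))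
  ∣p∣+∣q∣≤n+∣p∩q∣ (inside  ∷ p) (outside ∷ q) = s≤s (∣p∣+∣q∣≤n+∣p∩q∣ p q)
  ∣p∣+∣q∣≤n+∣p∩q∣ {suc n} (outside ∷ p) (inside  ∷ q) =
    subst (_≤ suc (n + ∣ p ∩ q ∣)) (sym (+-suc ∣ p ∣ ∣ q ∣)) (s≤s (∣p∣+∣q∣≤n+∣p∩q∣ p q))
  ∣p∣+∣q∣≤n+∣p∩q∣ (outside ∷ p) (outside ∷ q) = ≤-trans (∣p∣+∣q∣≤n+∣p∩q∣ p q) (n≤1+n _)

  ∩-nonempty : ∀ {n} (p q : Subset n) → n < ∣ p ∣ + ∣ q ∣ → Nonempty (p ∩ q)
  ∩-nonempty {n} p q n<∣p∣+∣q∣ with nonempty? (p ∩ q)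
  ... | yes nonempty = nonempty
  ... | no empty = ⊥-elim (<⇒≱ n<∣p∣+∣q∣ (subst (∣ p ∣ + ∣ q ∣ ≤_) n+∣p∩q∣≡n (∣p∣+∣q∣≤n+∣p∩q∣ p q)))
    where
    n+∣p∩q∣≡n : n + ∣ p ∩ q ∣ ≡ n
    n+∣p∩q∣≡n = trans (cong (λ r → n + ∣ r ∣) (Empty-unique empty)) (trans (cong (n +_) (∣⊥∣≡0 n)) (+-identityʳ n))

open SubsetCardinality

module OrientedOutDegree where

  open import Data.Nat
  open import Data.Nat.Properties
  open import Data.Bool using (Bool; true; false; _∧_; if_then_else_)
  open import Data.Bool.Properties using (¬-not)
  open import Data.Fin.Subset using (inside; outside; ⁅_⁆)
  open import Data.Fin.Subset.Properties using (x∈⁅y⁆⇒x≡y; ∣⁅x⁆∣≡1)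
  open import Data.Vec using ([]; _∷_; lookup)
  open import Data.Vec.Properties using ([]=⇒lookup; lookup⇒[]=; lookup-zipWith)
  open import Relation.Binary.PropositionalEquality using (cong₂; trans)
  open import Algebra.Properties.CommutativeSemigroup *-commutativeSemigroup using (x∙yz≈y∙xz)
  open import Algebra.Properties.Semiring.Sum +-*-semiring
    using (sum; ∑-comm; ∑-distrib-+; *-distribˡ-sum; *-distribʳ-sum; sum-cong-≗)

  indicator : Bool → ℕ
  indicator b = if b then 1 else 0

  χ : ∀ {n} → Subset n → Fin n → ℕ
  χ p i = indicator (lookup p i)

  ∣p∣≡∑χ : ∀ {n} (p : Subset n) → ∣ p ∣ ≡ sum (χ p)
  ∣p∣≡∑χ []            = refl
  ∣p∣≡∑χ (outside ∷ p) = ∣p∣≡∑χ p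
  ∣p∣≡∑χ (inside  ∷ p) = cong suc (∣p∣≡∑χ p)

  χ-∩ : ∀ {n} (p q : Subset n) i → χ (p ∩ q) i ≡ indicator (lookup p i ∧ lookup q i)
  χ-∩ p q i = cong indicator (lookup-zipWith _∧_ i p q)

  lookup-∉ : ∀ {n} {p : Subset n} {i} → i ∉ p → lookup p i ≡ false
  lookup-∉ {p = p} {i} i∉p = ¬-not (i∉p ∘ lookup⇒[]= i p)

  sum-mono-≤ : ∀ {n} {f g : Fin n → ℕ} → (∀ i → f i ≤ g i) → sum f ≤ sum g
  sum-mono-≤ {zero}  f≤g = z≤n
  sum-mono-≤ {suc n} f≤g = +-mono-≤ (f≤g Fin.zero) (sum-mono-≤ (f≤g ∘ Fin.suc))

  nonempty⇒0<∣p∣ : ∀ {n} {p : Subset n} → Nonempty p → 0 < ∣ p ∣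
  nonempty⇒0<∣p∣ {p = p} (x , x∈p) =
    subst (_≤ ∣ p ∣) (∣⁅x⁆∣≡1 x) (p⊆q⇒∣p∣≤∣q∣ (λ y∈⁅x⁆ → subst (_∈ₛ p) (sym (x∈⁅y⁆⇒x≡y x y∈⁅x⁆)) x∈p))

  module _ {n : ℕ} (S : Subset n) (out : Fin n → Subset n)
    (oriented : ∀ {v w} → v ∈ₛ S → w ∈ₛ S → w ∈ₛ out v → v ∉ out w) where

    private
      s : ℕ
      s = ∣ S ∣

      outdeg : Fin n → ℕ
      outdeg v = ∣ S ∩ out v ∣

      arc : Fin n → Fin n → ℕ
      arc v w = χ S v * χ (S ∩ out v) w

      arc-pair-bool : ∀ x y e f → (x ≡ true → y ≡ true → e ≡ true → f ≡ false) →
        indicator x * indicator (y ∧ e) + indicator y * indicator (x ∧ f) ≤ indicator x * indicator y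
      arc-pair-bool false false _     _     _ = z≤n
      arc-pair-bool false true  _     _     _ = z≤n
      arc-pair-bool true  false _     _     _ = z≤n
      arc-pair-bool true  true  false false _ = z≤n
      arc-pair-bool true  true  false true  _ = ≤-refl
      arc-pair-bool true  true  true  false _ = ≤-refl
      arc-pair-bool true  true  true  true  h with h refl refl refl
      ... | ()

      arc-pair : ∀ v w → arc v w + arc w v ≤ χ S v * χ S w
      arc-pair v w rewrite χ-∩ S (out v) w | χ-∩ S (out w) v =
        arc-pair-bool (lookup S v) (lookup S w) (lookup (out v) w) (lookup (out w) v)
          (λ v∈S w∈S w∈out → lookup-∉ (oriented (lookup⇒[]= v S v∈S) (lookup⇒[]= w S w∈S) (lookup⇒[]= w (out v) w∈out)))

      row-sum : ∀ v → sum (arc v) ≡ χ S v * outdeg v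
      row-sum v = trans (sym (*-distribˡ-sum (χ S v) (χ (S ∩ out v)))) (cong (χ S v *_) (sym (∣p∣≡∑χ (S ∩ out v))))

      -- Each pair {v, w} of vertices of S carries at most one arc.
      arcs-bound : 2 * sum (λ v → χ S v * outdeg v) ≤ s * s
      arcs-bound = begin
        2 * sum (λ v → χ S v * outdeg v)               ≡⟨ cong (2 *_) (sum-cong-≗ (sym ∘ row-sum)) ⟩
        2 * R                                          ≡⟨ cong (R +_) (+-identityʳ R) ⟩
        R + R                                          ≡⟨ cong (R +_) (∑-comm arc) ⟩
        R + sum (λ v → sum (λ w → arc w v))            ≡⟨ sym (∑-distrib-+ (λ v → sum (arc v)) _) ⟩
        sum (λ v → sum (arc v) + sum (λ w → arc w v))  ≡⟨ sum-cong-≗ (λ v → sym (∑-distrib-+ (arc v) _)) ⟩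
        sum (λ v → sum (λ w → arc v w + arc w v))      ≤⟨ sum-mono-≤ (λ v → sum-mono-≤ (arc-pair v)) ⟩
        sum (λ v → sum (λ w → χ S v * χ S w))          ≡⟨ sum-cong-≗ (λ v → sym (*-distribˡ-sum (χ S v) (χ S))) ⟩
        sum (λ v → χ S v * sum (χ S))                  ≡⟨ sym (*-distribʳ-sum (sum (χ S)) (χ S)) ⟩
        sum (χ S) * sum (χ S)                          ≡⟨ sym (cong₂ _*_ (∣p∣≡∑χ S) (∣p∣≡∑χ S)) ⟩
        s * s                                          ∎
        where
        open ≤-Reasoning
        R = sum (λ v → sum (arc v))

    low-outdegree : Nonempty S → ∃ λ v → v ∈ₛ S × 2 * ∣ S ∩ out v ∣ ≤ ∣ S ∣
    low-outdegree nonempty with any? (λ v → (v ∈? S) ×-dec (2 * ∣ S ∩ out v ∣ ≤? ∣ S ∣))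
    ... | yes found = found
    ... | no none = ⊥-elim (<⇒≱ (m<n+m (s * s) (nonempty⇒0<∣p∣ nonempty)) s+s*s≤s*s)
      where
      open ≤-Reasoning

      exceeds : ∀ v → χ S v * suc s ≤ χ S v * (2 * outdeg v)
      exceeds v with v ∈? S
      ... | yes v∈S rewrite []=⇒lookup v∈S = +-monoˡ-≤ 0 (≰⇒> (λ low → none (v , v∈S , low)))
      ... | no  v∉S rewrite lookup-∉ v∉S  = z≤n

      s+s*s≤s*s : s + s * s ≤ s * s
      s+s*s≤s*s = begin
        s + s * s                           ≡⟨ sym (*-suc s s) ⟩
        s * suc s                           ≡⟨ cong (_* suc s) (∣p∣≡∑χ S) ⟩
        sum (χ S) * suc s                   ≡⟨ *-distribʳ-sum (suc s) (χ S) ⟩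
        sum (λ v → χ S v * suc s)           ≤⟨ sum-mono-≤ exceeds ⟩
        sum (λ v → χ S v * (2 * outdeg v))  ≡⟨ sum-cong-≗ (λ v → x∙yz≈y∙xz (χ S v) 2 (outdeg v)) ⟩
        sum (λ v → 2 * (χ S v * outdeg v))  ≡⟨ sym (*-distribˡ-sum 2 (λ v → χ S v * outdeg v)) ⟩
        2 * sum (λ v → χ S v * outdeg v)    ≤⟨ arcs-bound ⟩
        s * s                               ∎

open OrientedOutDegree using (low-outdegree)

module GraphWalks {n : ℕ} (G : Graph n) where

  open import Data.Fin using (_≟_)
  open import Data.List using ([]; _∷_)
  open import Data.List.Membership.Propositional using (_∈_) renaming (_∉_ to _∉ₗ_)
  open import Data.List.Membership.DecPropositional (_≟_ {n}) using () renaming (_∈?_ to _∈ₗ?_)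
  open import Data.List.Relation.Unary.Any using (here; there)
  open import Data.List.Relation.Unary.All using (All; []; _∷_)
  open import Data.List.Relation.Unary.All.Properties using (¬Any⇒All¬)
  open import Data.List.Relation.Unary.AllPairs using ([]; _∷_)
  open import Data.List.Relation.Unary.Unique.Propositional using (Unique)

  data Walk (P : Fin n → Set) : Fin n → Fin n → Set where
    [_]    : ∀ {v} → P v → Walk P v v
    _∷⟨_⟩_ : ∀ {u w v} → P u → Adj G u w → Walk P w v → Walk P u v

  PathWithin : (Fin n → Set) → Fin n → Fin n → Set
  PathWithin P s t = ∃ λ vs → IsPath G s t vs × All P vs

  module _ {P : Fin n → Set} where

    _++ʷ_ : ∀ {u v w} → Walk P u v → Walk P v w → Walk P u w
    [ _ ]        ++ʷ q = q
    (p ∷⟨ a ⟩ w) ++ʷ q = p ∷⟨ a ⟩ (w ++ʷ q)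

    first-within : ∀ {u v} → Walk P u v → P u
    first-within [ p ]         = p
    first-within (p ∷⟨ _ ⟩ _) = p

    reverseʷ : ∀ {u v} → Walk P u v → Walk P v u
    reverseʷ [ p ]         = [ p ]
    reverseʷ (p ∷⟨ a ⟩ w) = reverseʷ w ++ʷ (first-within w ∷⟨ Graph.sym G a ⟩ [ p ])

  mapʷ : ∀ {P Q : Fin n → Set} → (∀ {x} → P x → Q x) → ∀ {u v} → Walk P u v → Walk Q u v
  mapʷ f [ p ]         = [ f p ]
  mapʷ f (p ∷⟨ a ⟩ w) = f p ∷⟨ a ⟩ mapʷ f w

  isWalk⇒walk : ∀ {P s t vs} → IsWalk G s t vs → All P vs → Walk P s t
  isWalk⇒walk (single _) (p ∷ []) = [ p ]
  isWalk⇒walk (step a w) (p ∷ ps) = p ∷⟨ a ⟩ isWalk⇒walk w ps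

  pathWithin⇒walk : ∀ {P s t} → PathWithin P s t → Walk P s t
  pathWithin⇒walk (_ , (w , _) , ps) = isWalk⇒walk w ps

  suffix : ∀ {P u v t vs} → IsWalk G v t vs → Unique vs → All P vs → u ∈ vs → PathWithin P u t
  suffix w@(single _) uq ps (here refl)                 = _ , (w , uq) , ps
  suffix w@(step _ _) uq ps (here refl)                 = _ , (w , uq) , ps
  suffix (step _ w) (_ ∷ uq) (_ ∷ ps) (there u∈vs) = suffix w uq ps u∈vs

  prepend : ∀ {P s v t vs} → P s → Adj G s v → IsWalk G v t vs → Unique vs → All P vs → s ∉ₗ vs →
    PathWithin P s t
  prepend p a w@(single _) uq ps s∉vs = _ , (step a w , ¬Any⇒All¬ _ s∉vs ∷ uq) , p ∷ ps
  prepend p a w@(step _ _) uq ps s∉vs = _ , (step a w , ¬Any⇒All¬ _ s∉vs ∷ uq) , p ∷ ps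

  -- Shortcut: if s recurs on the path obtained from the tail, start from its later occurrence.
  walk⇒pathWithin : ∀ {P s t} → Walk P s t → PathWithin P s t
  walk⇒pathWithin [ p ] = _ , (single _ , [] ∷ []) , p ∷ []
  walk⇒pathWithin {s = s} (p ∷⟨ a ⟩ w) with walk⇒pathWithin w
  ... | vs , (w′ , uq) , ps with s ∈ₗ? vs
  ...   | yes s∈vs = suffix w′ uq ps s∈vs
  ...   | no  s∉vs = prepend p a w′ uq ps s∉vs

module _ {n} {G : Graph n} {L : Labeling n} (cover : IsCuHL G L) where

  open GraphWalks G

  cover-blocks-crossing-walks : ∀ {v w x} → Walk (_∉ L v) w x → Walk (_∉ L w) v x → ⊥
  cover-blocks-crossing-walks {v} {w} w→x v→x
    with walk⇒pathWithin (mapʷ (λ y∉Lw y∈both → y∉Lw (proj₂ y∈both)) v→x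
                           ++ʷ reverseʷ (mapʷ (λ y∉Lv y∈both → y∉Lv (proj₁ y∈both)) w→x))
  ... | vs , path , avoids with cover v w vs path
  ... | y , y∈vs , y∈Lv , y∈Lw = All.lookup avoids y∈vs (y∈Lv , y∈Lw)

open import Data.Rational using (ℚ; ½; 1ℚ; _≤_; _<_; _*_; _-_)
import Data.Rational.Properties as ℚ

module ℕtoℚ-Properties where

  open import Data.Nat.Coprimality using (1-coprimeTo) renaming (sym to coprime-sym)
  import Data.Integer as ℤ
  open import Data.Integer using (+_)
  import Data.Integer.Properties as ℤ
  open import Data.Rational using (mkℚ; _/_; _+_; *≤*)
  open import Data.Rational.Properties using (normalize-coprime; <-irrefl; <-≤-trans)
  open import Relation.Binary.PropositionalEquality using (cong₂; trans)

  ℕtoℚ≡mkℚ : ∀ k → ℕtoℚ k ≡ mkℚ (+ k) 0 (coprime-sym (1-coprimeTo k))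
  ℕtoℚ≡mkℚ k = normalize-coprime (coprime-sym (1-coprimeTo k))

  ℕtoℚ-mono-≤ : ∀ {m n} → m ℕ.≤ n → ℕtoℚ m ≤ ℕtoℚ n
  ℕtoℚ-mono-≤ {m} {n} m≤n rewrite ℕtoℚ≡mkℚ m | ℕtoℚ≡mkℚ n =
    *≤* (subst₂ ℤ._≤_ (sym (ℤ.*-identityʳ (+ m))) (sym (ℤ.*-identityʳ (+ n))) (ℤ.+≤+ m≤n))

  ℕtoℚ-cancel-< : ∀ {m n} → ℕtoℚ m < ℕtoℚ n → m ℕ.< n
  ℕtoℚ-cancel-< m<n = ℕ.≰⇒> (λ n≤m → <-irrefl refl (<-≤-trans m<n (ℕtoℚ-mono-≤ n≤m)))

  ℕtoℚ-homo-+ : ∀ m n → ℕtoℚ (m ℕ.+ n) ≡ ℕtoℚ m + ℕtoℚ n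
  ℕtoℚ-homo-+ m n rewrite ℕtoℚ≡mkℚ m | ℕtoℚ≡mkℚ n =
    cong (_/ 1) (trans (ℤ.pos-+ m n) (sym (cong₂ ℤ._+_ (ℤ.*-identityʳ (+ m)) (ℤ.*-identityʳ (+ n)))))

open ℕtoℚ-Properties

module RationalBounds where

  open import Data.Rational using (0ℚ; _+_; -_; nonNegative)
  open import Data.Rational.Properties
  open import Data.Rational.Solver using (module +-*-Solver)
  open +-*-Solver
  open ≤-Reasoning

  αN<x∧αN<y⇒N<x+y : ∀ {α N x y} → ½ ≤ α → 0ℚ ≤ N → α * N < x → α * N < y → N < x + y
  αN<x∧αN<y⇒N<x+y {α} {N} {x} {y} ½≤α 0≤N αN<x αN<y = begin-strict
    N              ≡⟨ solve 1 (λ N → N := con ½ :* N :+ con ½ :* N) refl N ⟩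
    ½ * N + ½ * N  ≤⟨ +-mono-≤ ½N≤αN ½N≤αN ⟩
    α * N + α * N  <⟨ +-mono-< αN<x αN<y ⟩
    x + y          ∎
    where
    ½N≤αN : ½ * N ≤ α * N
    ½N≤αN = *-monoʳ-≤-nonNeg N {{nonNegative 0≤N}} ½≤α

  αN<c∧2c≤N+ℓ⇒[2α-1]N≤ℓ : ∀ {α N c ℓ} → α * N < c → c + c ≤ N + ℓ → (ℕtoℚ 2 * α - 1ℚ) * N ≤ ℓ
  αN<c∧2c≤N+ℓ⇒[2α-1]N≤ℓ {α} {N} {c} {ℓ} αN<c 2c≤N+ℓ = <⇒≤ (begin-strict
    (ℕtoℚ 2 * α - 1ℚ) * N  ≡⟨ solve 2 (λ α N → (con (ℕtoℚ 2) :* α :- con 1ℚ) :* N := α :* N :+ α :* N :- N) refl α N ⟩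
    α * N + α * N - N      <⟨ +-monoˡ-< (- N) (+-mono-< αN<c αN<c) ⟩
    c + c - N              ≤⟨ +-monoˡ-≤ (- N) 2c≤N+ℓ ⟩
    N + ℓ - N              ≡⟨ solve 2 (λ N ℓ → N :+ ℓ :- N := ℓ) refl N ℓ ⟩
    ℓ                      ∎)

  N≤ℓ⇒[2α-1]N≤ℓ : ∀ {α N ℓ} → α ≤ 1ℚ → 0ℚ ≤ N → N ≤ ℓ → (ℕtoℚ 2 * α - 1ℚ) * N ≤ ℓ
  N≤ℓ⇒[2α-1]N≤ℓ {α} {N} {ℓ} α≤1 0≤N N≤ℓ = begin
    (ℕtoℚ 2 * α - 1ℚ) * N  ≡⟨ solve 2 (λ α N → (con (ℕtoℚ 2) :* α :- con 1ℚ) :* N := α :* N :+ α :* N :- N) refl α N ⟩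
    α * N + α * N - N      ≤⟨ +-monoˡ-≤ (- N) (+-mono-≤ αN≤N αN≤N) ⟩
    1ℚ * N + 1ℚ * N - N    ≡⟨ solve 1 (λ N → con 1ℚ :* N :+ con 1ℚ :* N :- N := N) refl N ⟩
    N                      ≤⟨ N≤ℓ ⟩
    ℓ                      ∎
    where
    αN≤N : α * N ≤ 1ℚ * N
    αN≤N = *-monoʳ-≤-nonNeg N {{nonNegative 0≤N}} α≤1

  x≤ℓ⇒x≤2αℓ : ∀ {α x ℓ} → ½ ≤ α → 0ℚ ≤ ℓ → x ≤ ℓ → x ≤ ℕtoℚ 2 * α * ℓ
  x≤ℓ⇒x≤2αℓ {α} {x} {ℓ} ½≤α 0≤ℓ x≤ℓ = begin
    x               ≤⟨ x≤ℓ ⟩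
    ℓ               ≡⟨ *-identityˡ ℓ ⟨
    1ℚ * ℓ          ≤⟨ *-monoʳ-≤-nonNeg ℓ {{nonNegative 0≤ℓ}} (*-monoˡ-≤-nonNeg (ℕtoℚ 2) ½≤α) ⟩
    ℕtoℚ 2 * α * ℓ  ∎

open RationalBounds

module Components {n} (G : Graph n) (S : Subset n)
  (reach? : ∀ u w → Dec (ConnectedAvoiding G S u w)) where

  open GraphWalks G

  component : Fin n → Subset n
  component u = tabulate (λ w → ⌊ reach? u w ⌋)

  component-walk : ∀ {u x y} → x ∈ₛ component u → y ∈ₛ component u → Walk (_∉ S) x y
  component-walk {u} x∈ y∈ =
    reverseʷ (pathWithin⇒walk (∈-tabulate⁻ (reach? u) x∈)) ++ʷ pathWithin⇒walk (∈-tabulate⁻ (reach? u) y∈)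

  LargeComponent : ℚ → Fin n → Set
  LargeComponent α u = u ∉ S × α * ℕtoℚ n < ℕtoℚ ∣ component u ∣

  large? : ∀ α → Dec (∃ (LargeComponent α))
  large? α = any? (λ u → ¬? (u ∈? S) ×-dec (α * ℕtoℚ n ℚ.<? ℕtoℚ ∣ component u ∣))

  balanced-if-no-large : ∀ {α} → ¬ ∃ (LargeComponent α) → IsBalancedSeparator G α S
  balanced-if-no-large none u u∉S C C-connected = ℚ.≤-trans
    (ℕtoℚ-mono-≤ (p⊆q⇒∣p∣≤∣q∣ (λ w∈C → ∈-tabulate⁺ (reach? u) (C-connected _ w∈C))))
    (ℚ.≮⇒≥ (λ large → none (u , u∉S , large)))

c≤d+k∧2d≤u⇒c+c≤n+ℓ : ∀ {c d k u n ℓ} → c ℕ.≤ d ℕ.+ k → 2 ℕ.* d ℕ.≤ u → u ℕ.+ k ≡ n → k ℕ.≤ ℓ →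
  c ℕ.+ c ℕ.≤ n ℕ.+ ℓ
c≤d+k∧2d≤u⇒c+c≤n+ℓ {c} {d} {k} {u} {n} {ℓ} c≤d+k 2d≤u u+k≡n k≤ℓ = begin
  c ℕ.+ c                  ≤⟨ ℕ.+-mono-≤ c≤d+k c≤d+k ⟩
  (d ℕ.+ k) ℕ.+ (d ℕ.+ k)  ≡⟨ solve 2 (λ d k → (d :+ k) :+ (d :+ k) := con 2 :* d :+ k :+ k) refl d k ⟩
  2 ℕ.* d ℕ.+ k ℕ.+ k      ≤⟨ ℕ.+-monoˡ-≤ k (ℕ.+-monoˡ-≤ k 2d≤u) ⟩
  u ℕ.+ k ℕ.+ k            ≡⟨ cong (ℕ._+ k) u+k≡n ⟩
  n ℕ.+ k                  ≤⟨ ℕ.+-monoʳ-≤ n k≤ℓ ⟩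
  n ℕ.+ ℓ                  ∎
  where
  open ℕ.≤-Reasoning
  open import Data.Nat.Solver using (module +-*-Solver)
  open +-*-Solver

module LargeLabelCount {n} {G : Graph n} {L : Labeling n} (cover : IsCuHL G L)
  {α : ℚ} (½≤α : ½ ≤ α) (α≤1 : α ≤ 1ℚ)
  {b : ℕ} (minimal : ∀ S → IsBalancedSeparator G α S → b ℕ.≤ ∣ S ∣)
  (reach? : ∀ v u w → Dec (ConnectedAvoiding G (L v) u w)) where

  open GraphWalks G
  module C v = Components G (L v) (reach? v)

  ℓ : ℕ
  ℓ = ∣ LargeLabels L b ∣

  unbalanced : Subset n
  unbalanced = tabulate (λ v → ⌊ C.large? v α ⌋)

  -- Defined by matching on the decision rather than by 'with' on 'C.large? v α':
  -- with-abstraction over that term in the lemmas below is very slow to check.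
  largeComponentOf : ∀ v → Dec (∃ (C.LargeComponent v α)) → Subset n
  largeComponentOf v (yes (u , _)) = C.component v u
  largeComponentOf v (no _)        = ∅

  largeComponent : Fin n → Subset n
  largeComponent v = largeComponentOf v (C.large? v α)

  largeComponentOf-spec : ∀ {v} (large? : Dec (∃ (C.LargeComponent v α))) → ∃ (C.LargeComponent v α) →
    ∃ λ u → C.LargeComponent v α u × largeComponentOf v large? ≡ C.component v u
  largeComponentOf-spec (yes (u , large)) _     = u , large , refl
  largeComponentOf-spec (no none)         large = ⊥-elim (none large)

  largeComponent-spec : ∀ {v} → v ∈ₛ unbalanced →
    ∃ λ u → C.LargeComponent v α u × largeComponent v ≡ C.component v u
  largeComponent-spec {v} v∈U = largeComponentOf-spec (C.large? v α) (∈-tabulate⁻ (λ v → C.large? v α) v∈U)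

  largeComponent-large : ∀ {v} → v ∈ₛ unbalanced → α * ℕtoℚ n < ℕtoℚ ∣ largeComponent v ∣
  largeComponent-large v∈U =
    let _ , (_ , large) , eq = largeComponent-spec v∈U
    in subst (λ C → α * ℕtoℚ n < ℕtoℚ ∣ C ∣) (sym eq) large

  largeComponent-walk : ∀ {v x y} → v ∈ₛ unbalanced → x ∈ₛ largeComponent v → y ∈ₛ largeComponent v →
    Walk (_∉ L v) x y
  largeComponent-walk {v} v∈U x∈ y∈ =
    let _ , _ , eq = largeComponent-spec v∈U
    in C.component-walk v (subst (_ ∈ₛ_) eq x∈) (subst (_ ∈ₛ_) eq y∈)

  large-if-balanced : ∀ {v} → v ∉ unbalanced → v ∈ₛ LargeLabels L b
  large-if-balanced {v} v∉U = ∈-tabulate⁺ (λ v → b ℕ.≤? ∣ L v ∣)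
    (minimal (L v) (C.balanced-if-no-large v {α} (v∉U ∘ ∈-tabulate⁺ (λ v → C.large? v α))))

  largeComponents-oriented : ∀ {v w} → v ∈ₛ unbalanced → w ∈ₛ unbalanced →
    w ∈ₛ largeComponent v → v ∉ largeComponent w
  largeComponents-oriented {v} {w} v∈U w∈U w∈Cv v∈Cw =
    let x , x∈Cv∩Cw = ∩-nonempty (largeComponent v) (largeComponent w) n<∣Cv∣+∣Cw∣
        x∈Cv , x∈Cw = x∈p∩q⁻ (largeComponent v) (largeComponent w) x∈Cv∩Cw
    in cover-blocks-crossing-walks cover (largeComponent-walk v∈U w∈Cv x∈Cv) (largeComponent-walk w∈U v∈Cw x∈Cw)
    where
    n<∣Cv∣+∣Cw∣ : n ℕ.< ∣ largeComponent v ∣ ℕ.+ ∣ largeComponent w ∣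
    n<∣Cv∣+∣Cw∣ = ℕtoℚ-cancel-< (subst (ℕtoℚ n <_) (sym (ℕtoℚ-homo-+ ∣ largeComponent v ∣ ∣ largeComponent w ∣))
      (αN<x∧αN<y⇒N<x+y ½≤α (ℕtoℚ-mono-≤ (z≤n {n})) (largeComponent-large v∈U) (largeComponent-large w∈U)))

  ∣∁unbalanced∣≤ℓ : ∣ ∁ unbalanced ∣ ℕ.≤ ℓ
  ∣∁unbalanced∣≤ℓ = p⊆q⇒∣p∣≤∣q∣ {p = ∁ unbalanced} {q = LargeLabels L b} (large-if-balanced ∘ x∈∁p⇒x∉p)

  n≤ℓ-if-all-balanced : ¬ Nonempty unbalanced → n ℕ.≤ ℓ
  n≤ℓ-if-all-balanced none = subst (ℕ._≤ ℓ) (∣⊤∣≡n n)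
    (p⊆q⇒∣p∣≤∣q∣ {p = ⊤} {q = LargeLabels L b} (λ {v} _ → large-if-balanced (λ v∈U → none (v , v∈U))))

  2∣C∣≤n+ℓ-at-low-outdegree : ∀ {v} → 2 ℕ.* ∣ unbalanced ∩ largeComponent v ∣ ℕ.≤ ∣ unbalanced ∣ →
    ∣ largeComponent v ∣ ℕ.+ ∣ largeComponent v ∣ ℕ.≤ n ℕ.+ ℓ
  2∣C∣≤n+ℓ-at-low-outdegree {v} low = c≤d+k∧2d≤u⇒c+c≤n+ℓ
    (∣q∣≤∣p∩q∣+∣∁p∣ unbalanced (largeComponent v)) low (∣p∣+∣∁p∣≡n unbalanced) ∣∁unbalanced∣≤ℓ

  [2α-1]n≤ℓ : (ℕtoℚ 2 * α - 1ℚ) * ℕtoℚ n ≤ ℕtoℚ ℓ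
  [2α-1]n≤ℓ = by-cases (nonempty? unbalanced)
    where
    by-cases : Dec (Nonempty unbalanced) → (ℕtoℚ 2 * α - 1ℚ) * ℕtoℚ n ≤ ℕtoℚ ℓ
    by-cases (no none) =
      N≤ℓ⇒[2α-1]N≤ℓ {α} {ℕtoℚ n} α≤1 (ℕtoℚ-mono-≤ (z≤n {n})) (ℕtoℚ-mono-≤ (n≤ℓ-if-all-balanced none))
    by-cases (yes some) =
      let v , v∈U , low = low-outdegree unbalanced largeComponent largeComponents-oriented some
          c = ∣ largeComponent v ∣
      in αN<c∧2c≤N+ℓ⇒[2α-1]N≤ℓ {α} {ℕtoℚ n} (largeComponent-large v∈U)
           (subst₂ _≤_ (ℕtoℚ-homo-+ c c) (ℕtoℚ-homo-+ n ℓ) (ℕtoℚ-mono-≤ (2∣C∣≤n+ℓ-at-low-outdegree low)))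

¬¬-∀Fin : ∀ {m} {P : Fin m → Set} → (∀ i → ¬ ¬ P i) → ¬ ¬ (∀ i → P i)
¬¬-∀Fin {ℕ.zero}  _   k = k (λ ())
¬¬-∀Fin {ℕ.suc m} ¬¬P k = ¬¬P Fin.zero λ P0 → ¬¬-∀Fin (¬¬P ∘ Fin.suc) λ Ps → k λ where
  Fin.zero    → P0
  (Fin.suc i) → Ps i

-- Adj is an arbitrary relation, so connectivity in G − L(v) need not be
-- decidable; but the goal is a decidable inequality, so it suffices to derive it
-- from the double-negated decidability of the finitely many reachability questions.
mainTheorem8 : ∀ (n : ℕ) (G : Graph n) (L : Labeling n) → IsCuHL G L →
    ∀ (α : ℚ) → ½ ≤ α → α ≤ 1ℚ →
    ∀ (b : ℕ) → IsMinBalancedSeparatorSize G α b →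
    ((ℕtoℚ 2 * α) - 1ℚ) * ℕtoℚ n ≤ (ℕtoℚ 2 * α) * ℕtoℚ ∣ LargeLabels L b ∣
mainTheorem8 n G L cover α ½≤α α≤1 b (_ , minimal) =
  decidable-stable (_ ℚ.≤? _)
    (¬¬-map bound (¬¬-∀Fin λ v → ¬¬-∀Fin λ u → ¬¬-∀Fin λ w → ¬¬-excluded-middle))
  where
  bound : (∀ v u w → Dec (ConnectedAvoiding G (L v) u w)) →
    ((ℕtoℚ 2 * α) - 1ℚ) * ℕtoℚ n ≤ (ℕtoℚ 2 * α) * ℕtoℚ ∣ LargeLabels L b ∣
  bound reach? = x≤ℓ⇒x≤2αℓ ½≤α (ℕtoℚ-mono-≤ (z≤n {∣ LargeLabels L b ∣}))
    (LargeLabelCount.[2α-1]n≤ℓ cover ½≤α α≤1 minimal reach?)
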